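{- Let $G$ be a finite group of order $n$ and suppose $\mathcal{A}=\{A_1,\ldots,A_m\}$ is both an $(n,m,k,1)$-SEDF and an $(n,m,k,1)$-coSEDF in $G$ (equivalently, $\mathcal{A}$ and $\mathcal{A}^{ -1}=\{A_1^{ -1},\ldots,A_m^{ -1}\}$ are both $(n,m,k,1)$-SEDFs). Then $m=2$ or $k=1$.
   Context: Let $G$ be a group of order $n$ (written multiplicatively), $X^{ -1}=\{x^{ -1}:x\in X\}$. Pairwise disjoint $k$-subsets $A_1,\ldots,A_m$ ($m\ge2$) of $G$ form an $(n,m,k,\lambda)$-SEDF if for every $i$ the multiset $\{xy^{ -1}: x\in A_i, y\in\bigcup_{j\ne i}A_j\}$ contains every non-identity element of $G$ exactly $\lambda$ times, and an $(n,m,k,\lambda)$-coSEDF if for every $i$ the multiset $\{y^{ -1}x: x\in A_i, y\in\bigcup_{j\ne i}A_j\}$ contains every non-identity element of $G$ exactly $\lambda$ times. -}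

module Defs where

open import Level using (0ℓ)
open import Data.Nat using (ℕ; zero; suc; _+_; _≤_)
open import Data.Empty using (⊥)
open import Data.Fin using (Fin; zero; suc)
open import Data.Fin.Properties using (any?; _≟_)
open import Data.Fin.Subset using (Subset; _∈_; ∣_∣)
open import Data.Fin.Subset.Properties using (_∈?_)
open import Data.Product using (Σ; _×_; _,_)
open import Relation.Nullary using (Dec; yes; no; ¬_)
open import Relation.Nullary.Decidable using (_×-dec_; ¬?)
open import Relation.Binary.PropositionalEquality using (_≡_; _≢_)
open import Algebra.Structures using (IsGroup)

-- A finite group of order n, presented with carrier Fin n
-- (every group of order n is isomorphic to such a one).
record FiniteGroup (n : ℕ) : Set where
  infixl 7 _∙_
  field
    _∙_     : Fin n → Fin n → Fin n
    ε       : Fin n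
    _⁻¹     : Fin n → Fin n
    isGroup : IsGroup _≡_ _∙_ ε _⁻¹

sumFin : ∀ {n} → (Fin n → ℕ) → ℕ
sumFin {zero}  f = 0
sumFin {suc n} f = f zero + sumFin (λ x → f (suc x))

countFin : ∀ {n} {P : Fin n → Set} → ((x : Fin n) → Dec (P x)) → ℕ
countFin {zero}  P? = 0
countFin {suc n} P? with P? zero
... | yes _ = suc (countFin (λ x → P? (suc x)))
... | no  _ = countFin (λ x → P? (suc x))

module _ {n : ℕ} (G : FiniteGroup n) where
  open FiniteGroup G

  InOthers : ∀ {m} → (Fin m → Subset n) → Fin m → Fin n → Set
  InOthers {m} A i y = Σ (Fin m) λ j → (j ≢ i) × (y ∈ A j)

  InOthers? : ∀ {m} (A : Fin m → Subset n) (i : Fin m) (y : Fin n) → Dec (InOthers A i y)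
  InOthers? A i y = any? (λ j → ¬? (j ≟ i) ×-dec (y ∈? A j))

  sedfMult : ∀ {m} → (Fin m → Subset n) → Fin m → Fin n → ℕ
  sedfMult A i g = sumFin λ x → countFin λ y →
    (x ∈? A i) ×-dec (InOthers? A i y ×-dec ((x ∙ (y ⁻¹)) ≟ g))

  coSedfMult : ∀ {m} → (Fin m → Subset n) → Fin m → Fin n → ℕ
  coSedfMult A i g = sumFin λ x → countFin λ y →
    (x ∈? A i) ×-dec (InOthers? A i y ×-dec (((y ⁻¹) ∙ x) ≟ g))

  IsDisjointFamily : (m k : ℕ) → (Fin m → Subset n) → Set
  IsDisjointFamily m k A =
    (2 ≤ m) × ((i : Fin m) → ∣ A i ∣ ≡ k)
      × ((i j : Fin m) → i ≢ j → (x : Fin n) → x ∈ A i → x ∈ A j → ⊥)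

  IsSEDF : (m k λ' : ℕ) → (Fin m → Subset n) → Set
  IsSEDF m k λ' A = IsDisjointFamily m k A
    × ((i : Fin m) (g : Fin n) → g ≢ ε → sedfMult A i g ≡ λ')

  IsCoSEDF : (m k λ' : ℕ) → (Fin m → Subset n) → Set
  IsCoSEDF m k λ' A = IsDisjointFamily m k A
    × ((i : Fin m) (g : Fin n) → g ≢ ε → coSedfMult A i g ≡ λ')

-- Suppose m ≥ 3 and some block A_j contains b ≠ d. For each other block A_i, λ = 1 for A_i
-- gives a ∈ A_i and y outside A_i with a y⁻¹ = b d⁻¹, and y must lie in A_j: otherwise
-- a⁻¹ b = y⁻¹ d would be represented twice in the coSEDF multiset of A_j, by (b, a) and by (d, y).
-- Doing this for two blocks A_i, A_i' yields two representations y a⁻¹ = d b⁻¹ = y' a'⁻¹ in the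
-- SEDF multiset of A_j, so a = a' lies in two disjoint blocks. Hence every block has one element.
module Submission where

open import Defs
open import Level using (0ℓ)
open import Data.Nat using (ℕ; zero; suc; _+_; _≤_; _≤?_; z≤n; s≤s)
open import Data.Nat.Properties using (≤-trans; ≤-antisym; ≤-reflexive; ≤-pred; m≤m+n; m≤n+m; +-comm; +-mono-≤; +-monoʳ-≤; ≰⇒>; module ≤-Reasoning)
open import Data.Fin using (Fin; zero; suc)
open import Data.Fin.Properties using (_≟_; suc-injective)
open import Data.Fin.Subset using (Subset; _∈_; ∣_∣; inside; outside)
open import Data.Vec using (_∷_; here; there)
open import Data.Product using (Σ; ∃₂; _×_; _,_; proj₁)
open import Data.Sum using (_⊎_; inj₁; inj₂)
open import Data.Empty using (⊥; ⊥-elim)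
open import Relation.Nullary using (Dec; yes; no; ¬_)
open import Relation.Binary.PropositionalEquality using (_≡_; _≢_; refl; sym; cong; cong₂; subst; module ≡-Reasoning)
open import Algebra.Bundles using (Group)
open import Algebra.Structures using (IsGroup)
import Algebra.Properties.Group as GroupProperties

indicator : {P : Set} → Dec P → ℕ
indicator (yes _) = 1
indicator (no _)  = 0

module _ {P : Set} where

  indicator-yes : (P? : Dec P) → P → indicator P? ≡ 1
  indicator-yes (yes _) _  = refl
  indicator-yes (no ¬p) p = ⊥-elim (¬p p)

  indicator≥1⇒holds : (P? : Dec P) → 1 ≤ indicator P? → P
  indicator≥1⇒holds (yes p) _ = p

sumFin≥1⇒∃ : ∀ {n} (f : Fin n → ℕ) → 1 ≤ sumFin f → Σ (Fin n) λ x → 1 ≤ f x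
sumFin≥1⇒∃ {suc n} f h with f zero in eq
... | suc _ = zero , subst (1 ≤_) (sym eq) (s≤s z≤n)
... | zero with sumFin≥1⇒∃ (λ x → f (suc x)) h
...   | x , p = suc x , p

f≤sumFin : ∀ {n} (f : Fin n → ℕ) (x : Fin n) → f x ≤ sumFin f
f≤sumFin f zero    = m≤m+n _ _
f≤sumFin f (suc x) = ≤-trans (f≤sumFin (λ y → f (suc y)) x) (m≤n+m _ _)

f+f≤sumFin : ∀ {n} (f : Fin n → ℕ) {x x' : Fin n} → x ≢ x' → f x + f x' ≤ sumFin f
f+f≤sumFin f {zero}  {zero}   x≢x' = ⊥-elim (x≢x' refl)
f+f≤sumFin f {zero}  {suc x'} _    = +-monoʳ-≤ (f zero) (f≤sumFin (λ y → f (suc y)) x')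
f+f≤sumFin f {suc x} {zero}   _    =
  ≤-trans (≤-reflexive (+-comm (f (suc x)) (f zero))) (+-monoʳ-≤ (f zero) (f≤sumFin (λ y → f (suc y)) x))
f+f≤sumFin f {suc x} {suc x'} x≢x' =
  ≤-trans (f+f≤sumFin (λ y → f (suc y)) (λ e → x≢x' (cong suc e))) (m≤n+m _ _)

2≰1 : ¬ 2 ≤ 1
2≰1 (s≤s ())

countFin≡sumFin-indicator : ∀ {n} {P : Fin n → Set} (P? : ∀ x → Dec (P x)) →
                            countFin P? ≡ sumFin (λ x → indicator (P? x))
countFin≡sumFin-indicator {zero}  P? = refl
countFin≡sumFin-indicator {suc n} P? with P? zero
... | yes _ = cong suc (countFin≡sumFin-indicator (λ x → P? (suc x)))
... | no _  = countFin≡sumFin-indicator (λ x → P? (suc x))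

module _ {n : ℕ} {P : Fin n → Set} (P? : ∀ x → Dec (P x)) where
  open ≤-Reasoning

  countFin≥1⇒∃ : 1 ≤ countFin P? → Σ (Fin n) P
  countFin≥1⇒∃ h with sumFin≥1⇒∃ _ (subst (1 ≤_) (countFin≡sumFin-indicator P?) h)
  ... | x , p = x , indicator≥1⇒holds (P? x) p

  holds⇒countFin≥1 : ∀ {x} → P x → 1 ≤ countFin P?
  holds⇒countFin≥1 {x} p = begin
    1                                ≡⟨ sym (indicator-yes (P? x) p) ⟩
    indicator (P? x)                 ≤⟨ f≤sumFin _ x ⟩
    sumFin (λ y → indicator (P? y))  ≡⟨ sym (countFin≡sumFin-indicator P?) ⟩
    countFin P?                      ∎

  holds-twice⇒countFin≥2 : ∀ {x x'} → x ≢ x' → P x → P x' → 2 ≤ countFin P?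
  holds-twice⇒countFin≥2 {x} {x'} x≢x' p p' = begin
    1 + 1                                ≡⟨ sym (cong₂ _+_ (indicator-yes (P? x) p) (indicator-yes (P? x') p')) ⟩
    indicator (P? x) + indicator (P? x') ≤⟨ f+f≤sumFin _ x≢x' ⟩
    sumFin (λ y → indicator (P? y))      ≡⟨ sym (countFin≡sumFin-indicator P?) ⟩
    countFin P?                          ∎

module _ {n : ℕ} {Q : Fin n → Fin n → Set} (Q? : ∀ x y → Dec (Q x y)) where
  open ≤-Reasoning

  pairCount : ℕ
  pairCount = sumFin λ x → countFin (Q? x)

  pairCount≥1⇒∃ : 1 ≤ pairCount → ∃₂ Q
  pairCount≥1⇒∃ h with sumFin≥1⇒∃ _ h
  ... | x , p = x , countFin≥1⇒∃ (Q? x) p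

  pairCount≤1⇒unique : pairCount ≤ 1 → ∀ {x y x' y'} → Q x y → Q x' y' → x ≡ x' × y ≡ y'
  pairCount≤1⇒unique h {x} {y} {x'} {y'} q q' with x ≟ x' | y ≟ y'
  ... | yes refl | yes refl = refl , refl
  ... | yes refl | no y≢y'  = ⊥-elim (2≰1 (≤-trans sameFirst h))
    where
    sameFirst : 2 ≤ pairCount
    sameFirst = begin
      2               ≤⟨ holds-twice⇒countFin≥2 (Q? x) y≢y' q q' ⟩
      countFin (Q? x) ≤⟨ f≤sumFin _ x ⟩
      pairCount       ∎
  ... | no x≢x'  | _        = ⊥-elim (2≰1 (≤-trans differentFirst h))
    where
    differentFirst : 2 ≤ pairCount
    differentFirst = begin
      1 + 1                               ≤⟨ +-mono-≤ (holds⇒countFin≥1 (Q? x) q) (holds⇒countFin≥1 (Q? x') q') ⟩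
      countFin (Q? x) + countFin (Q? x')  ≤⟨ f+f≤sumFin _ x≢x' ⟩
      pairCount                           ∎

∣p∣≥1⇒∃ : ∀ {n} (p : Subset n) → 1 ≤ ∣ p ∣ → Σ (Fin n) (_∈ p)
∣p∣≥1⇒∃ (inside ∷ p)  _ = zero , here
∣p∣≥1⇒∃ (outside ∷ p) h with ∣p∣≥1⇒∃ p h
... | x , x∈p = suc x , there x∈p

∣p∣≥2⇒∃-distinct : ∀ {n} (p : Subset n) → 2 ≤ ∣ p ∣ → ∃₂ λ x y → x ≢ y × x ∈ p × y ∈ p
∣p∣≥2⇒∃-distinct (inside ∷ p) (s≤s h) with ∣p∣≥1⇒∃ p h
... | y , y∈p = zero , suc y , (λ ()) , here , there y∈p
∣p∣≥2⇒∃-distinct (outside ∷ p) h with ∣p∣≥2⇒∃-distinct p h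
... | x , y , x≢y , x∈p , y∈p = suc x , suc y , (λ e → x≢y (suc-injective e)) , there x∈p , there y∈p

module _ {n : ℕ} (G : FiniteGroup n) where
  open FiniteGroup G
  open IsGroup isGroup using (assoc)
  open ≡-Reasoning

  group : Group 0ℓ 0ℓ
  group = record { Carrier = Fin n ; _≈_ = _≡_ ; _∙_ = _∙_ ; ε = ε ; _⁻¹ = _⁻¹ ; isGroup = isGroup }

  open GroupProperties group using (⁻¹-injective; inverseˡ-unique; x∙y⁻¹≈ε⇒x≈y; ⁻¹-anti-homo-//; \\-leftDividesʳ; //-rightDividesˡ)

  x⁻¹∙y≡ε⇒x≡y : ∀ x y → x ⁻¹ ∙ y ≡ ε → x ≡ y
  x⁻¹∙y≡ε⇒x≡y x y e = ⁻¹-injective (inverseˡ-unique (x ⁻¹) y e)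

  x∙y⁻¹≡z∙w⁻¹⇒y⁻¹∙w≡x⁻¹∙z : ∀ {x y z w} → x ∙ y ⁻¹ ≡ z ∙ w ⁻¹ → y ⁻¹ ∙ w ≡ x ⁻¹ ∙ z
  x∙y⁻¹≡z∙w⁻¹⇒y⁻¹∙w≡x⁻¹∙z {x} {y} {z} {w} e = begin
    y ⁻¹ ∙ w                ≡⟨ sym (\\-leftDividesʳ x (y ⁻¹ ∙ w)) ⟩
    x ⁻¹ ∙ (x ∙ (y ⁻¹ ∙ w)) ≡⟨ cong (x ⁻¹ ∙_) (sym (assoc x (y ⁻¹) w)) ⟩
    x ⁻¹ ∙ (x ∙ y ⁻¹ ∙ w)   ≡⟨ cong (λ u → x ⁻¹ ∙ (u ∙ w)) e ⟩
    x ⁻¹ ∙ (z ∙ w ⁻¹ ∙ w)   ≡⟨ cong (x ⁻¹ ∙_) (//-rightDividesˡ w z) ⟩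
    x ⁻¹ ∙ z                ∎

  x∙y⁻¹≡z∙w⁻¹⇒y∙x⁻¹≡w∙z⁻¹ : ∀ {x y z w} → x ∙ y ⁻¹ ≡ z ∙ w ⁻¹ → y ∙ x ⁻¹ ≡ w ∙ z ⁻¹
  x∙y⁻¹≡z∙w⁻¹⇒y∙x⁻¹≡w∙z⁻¹ {x} {y} {z} {w} e = begin
    y ∙ x ⁻¹        ≡⟨ sym (⁻¹-anti-homo-// x y) ⟩
    (x ∙ y ⁻¹) ⁻¹   ≡⟨ cong _⁻¹ e ⟩
    (z ∙ w ⁻¹) ⁻¹   ≡⟨ ⁻¹-anti-homo-// z w ⟩
    w ∙ z ⁻¹        ∎

  module _ {m : ℕ} (A : Fin m → Subset n) where

    sedfMult≡1⇒∃ : ∀ {i g} → sedfMult G A i g ≡ 1 →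
                   ∃₂ λ x y → x ∈ A i × InOthers G A i y × x ∙ y ⁻¹ ≡ g
    sedfMult≡1⇒∃ e = pairCount≥1⇒∃ _ (≤-reflexive (sym e))

    sedfMult≡1⇒unique : ∀ {i g x y x' y'} → sedfMult G A i g ≡ 1 →
                        x ∈ A i × InOthers G A i y × x ∙ y ⁻¹ ≡ g →
                        x' ∈ A i × InOthers G A i y' × x' ∙ y' ⁻¹ ≡ g → x ≡ x' × y ≡ y'
    sedfMult≡1⇒unique e = pairCount≤1⇒unique _ (≤-reflexive e)

    coSedfMult≡1⇒unique : ∀ {i g x y x' y'} → coSedfMult G A i g ≡ 1 →
                          x ∈ A i × InOthers G A i y × y ⁻¹ ∙ x ≡ g →
                          x' ∈ A i × InOthers G A i y' × y' ⁻¹ ∙ x' ≡ g → x ≡ x' × y ≡ y'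
    coSedfMult≡1⇒unique e = pairCount≤1⇒unique _ (≤-reflexive e)

  module _ {m : ℕ} {A : Fin m → Subset n}
    (disjoint : ∀ i j → i ≢ j → ∀ x → x ∈ A i → x ∈ A j → ⊥)
    (sedf : ∀ i g → g ≢ ε → sedfMult G A i g ≡ 1)
    (coSedf : ∀ i g → g ≢ ε → coSedfMult G A i g ≡ 1) where

    ≢⇒∙⁻¹≢ε : ∀ {x y} → x ≢ y → x ∙ y ⁻¹ ≢ ε
    ≢⇒∙⁻¹≢ε x≢y e = x≢y (x∙y⁻¹≈ε⇒x≈y _ _ e)

    quotient-realised-into-block : ∀ {i j b d} → i ≢ j → b ≢ d → b ∈ A j → d ∈ A j →
                                   ∃₂ λ a y → a ∈ A i × y ∈ A j × a ∙ y ⁻¹ ≡ b ∙ d ⁻¹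
    quotient-realised-into-block {i} {j} {b} {d} i≢j b≢d b∈Aj d∈Aj
      with sedfMult≡1⇒∃ A (sedf i (b ∙ d ⁻¹) (≢⇒∙⁻¹≢ε b≢d))
    ... | a , y , a∈Ai , (l , l≢i , y∈Al) , eq with l ≟ j
    ...   | yes refl = a , y , a∈Ai , y∈Al , eq
    ...   | no l≢j   = ⊥-elim (b≢d (proj₁ (coSedfMult≡1⇒unique A (coSedf j (a ⁻¹ ∙ b) a⁻¹∙b≢ε)
                           (b∈Aj , (i , i≢j , a∈Ai) , refl)
                           (d∈Aj , (l , l≢j , y∈Al) , x∙y⁻¹≡z∙w⁻¹⇒y⁻¹∙w≡x⁻¹∙z eq))))
      where
      a⁻¹∙b≢ε : a ⁻¹ ∙ b ≢ ε
      a⁻¹∙b≢ε e with x⁻¹∙y≡ε⇒x≡y a b e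
      ... | refl = disjoint i j i≢j a a∈Ai b∈Aj

    two-other-blocks⇒∣A∣≤1 : ∀ {i i' j} → i ≢ i' → i ≢ j → i' ≢ j → ∣ A j ∣ ≤ 1
    two-other-blocks⇒∣A∣≤1 {i} {i'} {j} i≢i' i≢j i'≢j with 2 ≤? ∣ A j ∣
    ... | no ∣Aj∣≱2 = ≤-pred (≰⇒> ∣Aj∣≱2)
    ... | yes ∣Aj∣≥2 with ∣p∣≥2⇒∃-distinct (A j) ∣Aj∣≥2
    ...   | b , d , b≢d , b∈Aj , d∈Aj
      with quotient-realised-into-block i≢j b≢d b∈Aj d∈Aj | quotient-realised-into-block i'≢j b≢d b∈Aj d∈Aj
    ...   | a , y , a∈Ai , y∈Aj , eq | a' , y' , a'∈Ai' , y'∈Aj , eq'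
      with sedfMult≡1⇒unique A (sedf j (d ∙ b ⁻¹) (≢⇒∙⁻¹≢ε (λ e → b≢d (sym e))))
             (y∈Aj , (i , i≢j , a∈Ai) , x∙y⁻¹≡z∙w⁻¹⇒y∙x⁻¹≡w∙z⁻¹ eq)
             (y'∈Aj , (i' , i'≢j , a'∈Ai') , x∙y⁻¹≡z∙w⁻¹⇒y∙x⁻¹≡w∙z⁻¹ eq')
    ...   | _ , refl = ⊥-elim (disjoint i i' i≢i' a a∈Ai a'∈Ai')

proposition6p7 : (n m k : ℕ) (G : FiniteGroup n) (A : Fin m → Subset n)
    → 1 ≤ k → IsSEDF G m k 1 A → IsCoSEDF G m k 1 A → (m ≡ 2) ⊎ (k ≡ 1)
proposition6p7 n zero                k G A _   ((() , _) , _) _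
proposition6p7 n (suc zero)          k G A _   ((s≤s () , _) , _) _
proposition6p7 n (suc (suc zero))    k G A _   _ _ = inj₁ refl
proposition6p7 n (suc (suc (suc m))) k G A k≥1 ((_ , size , disjoint) , sedf) (_ , coSedf) =
  inj₂ (≤-antisym k≤1 k≥1)
  where
  k≤1 : k ≤ 1
  k≤1 = subst (_≤ 1) (size zero)
          (two-other-blocks⇒∣A∣≤1 G disjoint sedf coSedf {suc zero} {suc (suc zero)} {zero} (λ ()) (λ ()) (λ ()))
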